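{- Let $n\ge 7$ be odd and let $C_4$ be the $(n-1)\times(n-1)$ matrix defined in the context. Let $Y$ be the $(n-1)\times(n-1)$ matrix given by $Ye^1=e^1$, $Ye^2=e^2$; for odd $k$ with $3\le k\le n-2$, $Ye^k=-F_{k-2}e^1+\sum_{i=2}^{k-1}(-1)^{i+1}F_{k-i}e^i+e^k$; for even $k$ with $4\le k\le n-3$, $Ye^k=F_{k-2}e^1+\sum_{i=2}^{k-1}(-1)^{i}F_{k-i}e^i+e^k$; and $Ye^{n-1}=-F_{n-4}e^1+\sum_{i=2}^{n-3}(-1)^{i+1}F_{n-2-i}e^i+e^{n-1}$. Then $Y=C_4^{ -1}$.
   Context: $F_m$ is the $m$-th Fibonacci number, $F_1=F_2=1$, $F_{m+1}=F_m+F_{m-1}$. $e^1,\dots,e^{n-1}$ are the standard basis vectors of $\mathbb{R}^{n-1}$. $C_4$ is the $(n-1)\times(n-1)$ matrix with $C_4e^1=e^1$, $C_4e^2=e^2$; for odd $k$ with $3\le k\le n-2$, $C_4e^k=e^1+\sum_{i=1}^{(k-1)/2}e^{2i}+e^k$; for even $k$ with $4\le k\le n-3$, $C_4e^k=\sum_{i=1}^{(k-2)/2}e^{2i+1}+e^k$; and $C_4e^{n-1}=e^1+\sum_{i=1}^{(n-3)/2}e^{2i}+e^{n-1}$. -}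

module Defs where

open import Data.Nat as ℕ using (ℕ; zero; suc; _∸_; _≡ᵇ_; _%_; _/_)
open import Data.Bool using (Bool; true; false; if_then_else_)
open import Data.Fin using (Fin; toℕ)
open import Data.List using (List; map; upTo; foldr)
open import Data.Integer using (ℤ; +_; -_; _+_; _*_; _^_)
open import Relation.Binary.PropositionalEquality using (_≡_)
open import Data.Product using (_×_)

fib : ℕ → ℕ
fib 0 = 0
fib 1 = 1
fib (suc (suc m)) = fib (suc m) ℕ.+ fib m

F : ℕ → ℤ
F m = + fib m

-- vectors of ℝ^d (entries in ℤ; used with d = n-1), indexed by Fin d;
-- coordinate j : Fin d is the 1-based coordinate toℕ j + 1
Vec : ℕ → Set
Vec d = Fin d → ℤ

e : ∀ {n} → ℕ → Vec n
e i j = if (ℕ.suc (toℕ j) ≡ᵇ i) then + 1 else + 0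

_⊕_ : ∀ {n} → Vec n → Vec n → Vec n
(u ⊕ v) j = u j + v j
infixl 6 _⊕_

_·_ : ∀ {n} → ℤ → Vec n → Vec n
(c · v) j = c * v j
infixr 7 _·_

0v : ∀ {n} → Vec n
0v j = + 0

range : ℕ → ℕ → List ℕ
range a b = map (a ℕ.+_) (upTo (suc b ∸ a))

-- Σ_{i=a}^{b} f i  (empty sum = 0 if b < a)
Σv : ∀ {n} → ℕ → ℕ → (ℕ → Vec n) → Vec n
Σv a b f = foldr (λ i acc → f i ⊕ acc) 0v (range a b)

isOdd : ℕ → Bool
isOdd k = k % 2 ≡ᵇ 1

C4col : (n : ℕ) → ℕ → Vec (n ∸ 1)
C4col n k =
  if k ≡ᵇ 1 then e 1 else
  if k ≡ᵇ 2 then e 2 else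
  if k ≡ᵇ (n ∸ 1) then e 1 ⊕ Σv 1 ((n ∸ 3) / 2) (λ i → e (2 ℕ.* i)) ⊕ e (n ∸ 1) else
  if isOdd k
    then e 1 ⊕ Σv 1 ((k ∸ 1) / 2) (λ i → e (2 ℕ.* i)) ⊕ e k
    else Σv 1 ((k ∸ 2) / 2) (λ i → e (2 ℕ.* i ℕ.+ 1)) ⊕ e k

Ycol : (n : ℕ) → ℕ → Vec (n ∸ 1)
Ycol n k =
  if k ≡ᵇ 1 then e 1 else
  if k ≡ᵇ 2 then e 2 else
  if k ≡ᵇ (n ∸ 1)
    then (- F (n ∸ 4)) · e 1
         ⊕ Σv 2 (n ∸ 3) (λ i → ((- + 1) ^ (i ℕ.+ 1) * F (n ∸ 2 ∸ i)) · e i)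
         ⊕ e (n ∸ 1) else
  if isOdd k
    then (- F (k ∸ 2)) · e 1
         ⊕ Σv 2 (k ∸ 1) (λ i → ((- + 1) ^ (i ℕ.+ 1) * F (k ∸ i)) · e i)
         ⊕ e k
    else F (k ∸ 2) · e 1
         ⊕ Σv 2 (k ∸ 1) (λ i → ((- + 1) ^ i * F (k ∸ i)) · e i)
         ⊕ e k

-- d×d matrices (used with d = n-1); M i j = entry in row i, column j
Mat : ℕ → Set
Mat d = Fin d → Fin d → ℤ

-- the matrix whose k-th column (1-based) is col k
fromCols : ∀ {n} → (ℕ → Vec n) → Mat n
fromCols col i j = col (suc (toℕ j)) i

C4 : (n : ℕ) → Mat (n ∸ 1)
C4 n = fromCols (C4col n)

Y : (n : ℕ) → Mat (n ∸ 1)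
Y n = fromCols (Ycol n)

sumFin : ∀ {m} → (Fin m → ℤ) → ℤ
sumFin {zero} f = + 0
sumFin {suc m} f = f Fin.zero + sumFin (λ i → f (Fin.suc i))

_⊗_ : ∀ {n} → Mat n → Mat n → Mat n
(A ⊗ B) i j = sumFin (λ l → A i l * B l j)

Id : (d : ℕ) → Mat d
Id d i j = if (toℕ i ≡ᵇ toℕ j) then + 1 else + 0

IsInverseOf : ∀ {n} → Mat n → Mat n → Set
IsInverseOf {d} B A = (∀ i j → (A ⊗ B) i j ≡ Id d i j) × (∀ i j → (B ⊗ A) i j ≡ Id d i j)

module Submission where

open import Defs
open import Data.Nat using (ℕ; _≤_; _%_)
open import Relation.Binary.PropositionalEquality using (_≡_)

open import Data.Nat as ℕ using (zero; suc; _<_; _∸_; _≡ᵇ_; _/_; s≤s; z≤n)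
import Data.Nat.Properties as ℕP
open import Data.Nat.DivMod using (m*n/n≡m)
open import Data.Bool using (true; false)
open import Data.Fin using (Fin; toℕ)
import Data.Fin as Fin using (zero; suc)
open import Data.Fin.Properties using (toℕ<n)
open import Data.List using (foldr; applyUpTo)
open import Data.List.Properties using (map-upTo)
open import Data.Integer using (ℤ; +_; -_; _+_; _-_; _*_; _^_)
open import Data.Integer.Properties using (*-zeroʳ; *-identityʳ; *-identityˡ; *-comm; +-identityʳ; +-identityˡ; -1*i≡-i; ^-distribˡ-+-*)
open import Data.Integer.Tactic.RingSolver using (solve-∀)
open import Data.Product using (_,_)
open import Data.Sum using (inj₁; inj₂)
open import Function using (_∘_)
open import Relation.Nullary.Decidable using (dec-true; dec-false)
open import Relation.Binary.PropositionalEquality using (refl; sym; trans; cong; cong₂; cong-app; _≢_; _≗_; module ≡-Reasoning)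

-- Write c_k and y_k for the k-th columns of C₄ and Y. Both families follow simple
-- recurrences in k:  c_1 = e^1, c_2 = e^2, c_3 = e^1+e^2+e^3, c_{k+2} = c_k + e^{k+1} + e^{k+2} - e^k,
-- and  y_1 = e^1, y_2 = e^2, y_3 = e^3-e^1-e^2, y_{k+2} = y_k - y_{k+1} + e^{k+2} - e^k,
-- the latter being the Fibonacci recurrence F_{m+2} = F_{m+1} + F_m acting on the
-- coefficients of y_k; the last column of either matrix is the one before it with the
-- diagonal entry moved:  x_{n-1} = x_{n-2} - e^{n-2} + e^{n-1}.  Since a matrix acts
-- linearly and sends e^k to its k-th column, induction on k then gives C₄ y_k = e^k
-- and Y c_k = e^k, i.e. C₄ Y = Y C₄ = I.

-- Doubling by recursion, so that  2 + double s  and  double (suc s)  agree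
-- definitionally; odd and even indices are written  suc (double s)  and  double s.
double : ℕ → ℕ
double zero    = zero
double (suc s) = suc (suc (double s))

double≡*2 : ∀ s → double s ≡ s ℕ.* 2
double≡*2 zero    = refl
double≡*2 (suc s) = cong (suc ∘ suc) (double≡*2 s)

2*≡double : ∀ s → 2 ℕ.* s ≡ double s
2*≡double s = trans (ℕP.*-comm 2 s) (sym (double≡*2 s))

half-double : ∀ s → double s / 2 ≡ s
half-double s = trans (cong (_/ 2) (double≡*2 s)) (m*n/n≡m s 2)

data Parity : ℕ → Set where
  even : ∀ s → Parity (double s)
  odd  : ∀ s → Parity (suc (double s))

parity : ∀ k → Parity k
parity zero          = even zero
parity (suc zero)    = odd zero
parity (suc (suc k)) with parity k
... | even s = even (suc s)
... | odd s  = odd (suc s)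

isOdd-double : ∀ s → isOdd (double s) ≡ false
isOdd-double zero    = refl
isOdd-double (suc s) = isOdd-double s

isOdd-suc-double : ∀ s → isOdd (suc (double s)) ≡ true
isOdd-suc-double zero    = refl
isOdd-suc-double (suc s) = isOdd-suc-double s

≢⇒≡ᵇ-false : ∀ {a b} → a ≢ b → (a ≡ᵇ b) ≡ false
≢⇒≡ᵇ-false {a} {b} = dec-false (a ℕ.≟ b)

≡ᵇ-refl : ∀ a → (a ≡ᵇ a) ≡ true
≡ᵇ-refl a = dec-true (a ℕ.≟ a) refl

sign : ℕ → ℤ
sign m = (- + 1) ^ m

sign-sq : ∀ m → sign m * sign m ≡ + 1
sign-sq zero    = refl
sign-sq (suc m) = trans (neg-sq (sign m)) (sign-sq m)
  where
  neg-sq : ∀ x → (- + 1 * x) * (- + 1 * x) ≡ x * x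
  neg-sq = solve-∀

sign-double : ∀ s → sign (double s) ≡ + 1
sign-double zero    = refl
sign-double (suc s) = cong (λ x → - + 1 * (- + 1 * x)) (sign-double s)

sign-suc-double : ∀ s → sign (suc (double s)) ≡ - + 1
sign-suc-double s = cong (λ x → - + 1 * x) (sign-double s)

sumFin-cong : ∀ {m} {f g : Fin m → ℤ} → f ≗ g → sumFin f ≡ sumFin g
sumFin-cong {zero}  p = refl
sumFin-cong {suc m} p = cong₂ _+_ (p Fin.zero) (sumFin-cong (p ∘ Fin.suc))

sumFin-zero : ∀ {m} {f : Fin m → ℤ} → (∀ l → f l ≡ + 0) → sumFin f ≡ + 0
sumFin-zero {zero}  p = refl
sumFin-zero {suc m} p = cong₂ _+_ (p Fin.zero) (sumFin-zero (p ∘ Fin.suc))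

sumFin-+ : ∀ {m} (f g : Fin m → ℤ) → sumFin (λ l → f l + g l) ≡ sumFin f + sumFin g
sumFin-+ {zero}  f g = refl
sumFin-+ {suc m} f g =
  trans (cong (λ s → f Fin.zero + g Fin.zero + s) (sumFin-+ (f ∘ Fin.suc) (g ∘ Fin.suc)))
        (interchange (f Fin.zero) (g Fin.zero) _ _)
  where
  interchange : ∀ a b c d → a + b + (c + d) ≡ a + c + (b + d)
  interchange = solve-∀

sumFin-- : ∀ {m} (f g : Fin m → ℤ) → sumFin (λ l → f l - g l) ≡ sumFin f - sumFin g
sumFin-- {zero}  f g = refl
sumFin-- {suc m} f g =
  trans (cong (λ s → f Fin.zero - g Fin.zero + s) (sumFin-- (f ∘ Fin.suc) (g ∘ Fin.suc)))
        (interchange (f Fin.zero) (g Fin.zero) _ _)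
  where
  interchange : ∀ a b c d → a - b + (c - d) ≡ a + c - (b + d)
  interchange = solve-∀

sumUpTo : ℕ → (ℕ → ℤ) → ℤ
sumUpTo c f = sumFin {c} (f ∘ toℕ)

sumUpTo-snoc : ∀ c f → sumUpTo (suc c) f ≡ sumUpTo c f + f c
sumUpTo-snoc zero    f = trans (+-identityʳ (f 0)) (sym (+-identityˡ (f 0)))
sumUpTo-snoc (suc c) f =
  trans (cong (λ s → f 0 + s) (sumUpTo-snoc c (f ∘ suc)))
        (assoc (f 0) (sumUpTo c (f ∘ suc)) (f (suc c)))
  where
  assoc : ∀ a b c → a + (b + c) ≡ a + b + c
  assoc = solve-∀

sumUpTo-- : ∀ c f g → sumUpTo c (λ i → f i - g i) ≡ sumUpTo c f - sumUpTo c g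
sumUpTo-- c f g = sumFin-- {c} (f ∘ toℕ) (g ∘ toℕ)

sumUpTo-cong : ∀ c {f g : ℕ → ℤ} → (∀ i → i < c → f i ≡ g i) → sumUpTo c f ≡ sumUpTo c g
sumUpTo-cong c p = sumFin-cong (λ l → p (toℕ l) (toℕ<n l))

foldr-applyUpTo : ∀ {d} (f : ℕ → Vec d) (g : ℕ → ℕ) c j →
  foldr (λ i acc → f i ⊕ acc) 0v (applyUpTo g c) j ≡ sumUpTo c (λ i → f (g i) j)
foldr-applyUpTo f g zero    j = refl
foldr-applyUpTo f g (suc c) j = cong (λ s → f (g 0) j + s) (foldr-applyUpTo f (g ∘ suc) c j)

Σv-sumUpTo : ∀ {d} a b (f : ℕ → Vec d) j → Σv a b f j ≡ sumUpTo (suc b ∸ a) (λ i → f (a ℕ.+ i) j)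
Σv-sumUpTo a b f j =
  trans (cong (λ xs → foldr (λ i acc → f i ⊕ acc) 0v xs j) (map-upTo (a ℕ.+_) (suc b ∸ a)))
        (foldr-applyUpTo f (a ℕ.+_) (suc b ∸ a) j)

_⊖_ : ∀ {d} → Vec d → Vec d → Vec d
(u ⊖ v) j = u j - v j
infixl 6 _⊖_

-- The action of a matrix on a vector; (A ⊗ fromCols b) has columns A *ᵥ b k.
_*ᵥ_ : ∀ {d} → Mat d → Vec d → Vec d
(M *ᵥ v) i = sumFin (λ l → M i l * v l)
infixr 8 _*ᵥ_

record Sends {d} (M : Mat d) (u v : Vec d) : Set where
  constructor sends
  field image : M *ᵥ u ≗ v
open Sends public

module _ {d} {M : Mat d} where

  sends-cong : ∀ {u u′ v} → u ≗ u′ → Sends M u′ v → Sends M u v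
  sends-cong p (sends q) = sends (λ i → trans (sumFin-cong (λ l → cong (M i l *_) (p l))) (q i))

  sends-⊕ : ∀ {a b a′ b′} → Sends M a a′ → Sends M b b′ → Sends M (a ⊕ b) (a′ ⊕ b′)
  sends-⊕ {a} {b} {a′} {b′} (sends p) (sends q) = sends λ i → begin
    sumFin (λ l → M i l * (a l + b l))           ≡⟨ sumFin-cong (λ l → distrib (M i l) (a l) (b l)) ⟩
    sumFin (λ l → M i l * a l + M i l * b l)     ≡⟨ sumFin-+ (λ l → M i l * a l) (λ l → M i l * b l) ⟩
    (M *ᵥ a) i + (M *ᵥ b) i                      ≡⟨ cong₂ _+_ (p i) (q i) ⟩
    a′ i + b′ i                                  ∎
    where
    open ≡-Reasoning
    distrib : ∀ x y z → x * (y + z) ≡ x * y + x * z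
    distrib = solve-∀

  sends-⊖ : ∀ {a b a′ b′} → Sends M a a′ → Sends M b b′ → Sends M (a ⊖ b) (a′ ⊖ b′)
  sends-⊖ {a} {b} {a′} {b′} (sends p) (sends q) = sends λ i → begin
    sumFin (λ l → M i l * (a l - b l))           ≡⟨ sumFin-cong (λ l → distrib (M i l) (a l) (b l)) ⟩
    sumFin (λ l → M i l * a l - M i l * b l)     ≡⟨ sumFin-- (λ l → M i l * a l) (λ l → M i l * b l) ⟩
    (M *ᵥ a) i - (M *ᵥ b) i                      ≡⟨ cong₂ _-_ (p i) (q i) ⟩
    a′ i - b′ i                                  ∎
    where
    open ≡-Reasoning
    distrib : ∀ x y z → x * (y - z) ≡ x * y - x * z
    distrib = solve-∀

sumFin-select : ∀ {m} (g : ℕ → ℤ) k → 1 ≤ k → k ≤ m →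
  sumFin {m} (λ l → g (suc (toℕ l)) * e k l) ≡ g k
sumFin-select {suc m} g (suc zero) _ _ =
  trans (cong₂ _+_ (*-identityʳ (g 1)) (sumFin-zero {m} (λ l → *-zeroʳ (g (suc (suc (toℕ l)))))))
        (+-identityʳ (g 1))
sumFin-select {suc m} g (suc (suc k)) _ (s≤s k<m) =
  trans (cong₂ _+_ (*-zeroʳ (g 1)) (sumFin-select (g ∘ suc) (suc k) (s≤s z≤n) k<m))
        (+-identityˡ (g (suc (suc k))))

sends-basis : ∀ {d} (col : ℕ → Vec d) k → 1 ≤ k → k ≤ d → Sends (fromCols col) (e k) (col k)
sends-basis col k 1≤k k≤d = sends (λ i → sumFin-select (λ k → col k i) k 1≤k k≤d)

product-is-identity : ∀ {d} (A : Mat d) (b : ℕ → Vec d) →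
  (∀ k → 1 ≤ k → k ≤ d → Sends A (b k) (e k)) → ∀ i j → (A ⊗ fromCols b) i j ≡ Id d i j
product-is-identity A b sends-b i j = image (sends-b (suc (toℕ j)) (s≤s z≤n) (toℕ<n j)) i

-- Induction over the column indices 1, …, 4+t in the pattern the recurrences follow:
-- three initial columns, a two-step recurrence below the last column, and the last
-- column obtained from the one before it.
column-induction : ∀ t (X : ℕ → Set) → X 1 → X 2 → X 3 →
  (∀ k → 2 ≤ k → 2 ℕ.+ k < 4 ℕ.+ t → X k → X (1 ℕ.+ k) → X (2 ℕ.+ k)) →
  (X (3 ℕ.+ t) → X (4 ℕ.+ t)) →
  ∀ k → 1 ≤ k → k ≤ 4 ℕ.+ t → X k
column-induction t X x₁ x₂ x₃ step last = every
  where
  below : ∀ m → m ≤ 1 ℕ.+ t → X (2 ℕ.+ m)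
  below zero          _ = x₂
  below (suc zero)    _ = x₃
  below (suc (suc m)) h = step (2 ℕ.+ m) (s≤s (s≤s z≤n)) (s≤s (s≤s (s≤s h)))
                               (below m (ℕP.<⇒≤ (ℕP.<⇒≤ h))) (below (suc m) (ℕP.<⇒≤ h))

  every : ∀ k → 1 ≤ k → k ≤ 4 ℕ.+ t → X k
  every (suc zero)    _ _ = x₁
  every (suc (suc m)) _ h with ℕP.m≤n⇒m<n∨m≡n h
  ... | inj₁ (s≤s (s≤s (s≤s m≤1+t))) = below m m≤1+t
  ... | inj₂ refl                      = last (below (suc t) ℕP.≤-refl)

record ColumnRecurrences (t : ℕ) (c y : ℕ → Vec (4 ℕ.+ t)) : Set where
  field
    c-1    : c 1 ≗ e 1
    c-2    : c 2 ≗ e 2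
    c-3    : c 3 ≗ e 1 ⊕ e 2 ⊕ e 3
    c-step : ∀ k → 2 ≤ k → 2 ℕ.+ k < 4 ℕ.+ t →
             c (2 ℕ.+ k) ≗ c k ⊕ e (1 ℕ.+ k) ⊕ e (2 ℕ.+ k) ⊖ e k
    c-last : c (4 ℕ.+ t) ≗ c (3 ℕ.+ t) ⊖ e (3 ℕ.+ t) ⊕ e (4 ℕ.+ t)
    y-1    : y 1 ≗ e 1
    y-2    : y 2 ≗ e 2
    y-3    : y 3 ≗ e 3 ⊖ e 1 ⊖ e 2
    y-step : ∀ k → 2 ≤ k → 2 ℕ.+ k < 4 ℕ.+ t →
             y (2 ℕ.+ k) ≗ y k ⊖ y (1 ℕ.+ k) ⊕ e (2 ℕ.+ k) ⊖ e k
    y-last : y (4 ℕ.+ t) ≗ y (3 ℕ.+ t) ⊖ e (3 ℕ.+ t) ⊕ e (4 ℕ.+ t)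

private
  cancel-initial : ∀ a b x → a + b + x - a - b ≡ x
  cancel-initial = solve-∀

  cancel-initial′ : ∀ a b x → a + b + (x - a - b) ≡ x
  cancel-initial′ = solve-∀

  cancel-last : ∀ a x b → a - x + (x - a + b) ≡ b
  cancel-last = solve-∀

  cancel-step : ∀ a a′ b x → a - a′ + (x + a′ + b - a) - x ≡ b
  cancel-step = solve-∀

  cancel-step′ : ∀ a b x x′ → a + x′ + (x - x′ + b - a) - x ≡ b
  cancel-step′ = solve-∀

module _ {t} {c y : ℕ → Vec (4 ℕ.+ t)} (R : ColumnRecurrences t c y) where
  open ColumnRecurrences R
  open ≡-Reasoning

  private
    d = 4 ℕ.+ t
    Mc = fromCols c
    My = fromCols y

    1≤k : ∀ {k} → 2 ≤ k → 1 ≤ k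
    1≤k = ℕP.≤-trans (s≤s z≤n)

    1≤d : 1 ≤ d
    1≤d = s≤s z≤n

    2≤d : 2 ≤ d
    2≤d = s≤s (s≤s z≤n)

    3≤d : 3 ≤ d
    3≤d = s≤s (s≤s (s≤s z≤n))

    3+t≤d : 3 ℕ.+ t ≤ d
    3+t≤d = ℕP.n≤1+n _

    c-e : ∀ k → 1 ≤ k → k ≤ d → Sends Mc (e k) (c k)
    c-e = sends-basis c

    y-e : ∀ k → 1 ≤ k → k ≤ d → Sends My (e k) (y k)
    y-e = sends-basis y

    c-e₁ : Sends Mc (e 1) (e 1)
    c-e₁ = sends (λ i → trans (image (c-e 1 (s≤s z≤n) 1≤d) i) (c-1 i))

    c-e₂ : Sends Mc (e 2) (e 2)
    c-e₂ = sends (λ i → trans (image (c-e 2 (s≤s z≤n) 2≤d) i) (c-2 i))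

    y-e₁ : Sends My (e 1) (e 1)
    y-e₁ = sends (λ i → trans (image (y-e 1 (s≤s z≤n) 1≤d) i) (y-1 i))

    y-e₂ : Sends My (e 2) (e 2)
    y-e₂ = sends (λ i → trans (image (y-e 2 (s≤s z≤n) 2≤d) i) (y-2 i))

  Mc-sends-y : ∀ k → 1 ≤ k → k ≤ d → Sends Mc (y k) (e k)
  Mc-sends-y = column-induction t (λ k → Sends Mc (y k) (e k)) sends-1 sends-2 sends-3 sends-step sends-last
    where
    sends-1 : Sends Mc (y 1) (e 1)
    sends-1 = sends-cong y-1 c-e₁

    sends-2 : Sends Mc (y 2) (e 2)
    sends-2 = sends-cong y-2 c-e₂

    sends-3 : Sends Mc (y 3) (e 3)
    sends-3 = sends λ i → begin
      (Mc *ᵥ y 3) i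
        ≡⟨ image (sends-cong y-3 (sends-⊖ (sends-⊖ (c-e 3 (s≤s z≤n) 3≤d) c-e₁) c-e₂)) i ⟩
      c 3 i - e 1 i - e 2 i
        ≡⟨ cong (λ z → z - e 1 i - e 2 i) (c-3 i) ⟩
      e 1 i + e 2 i + e 3 i - e 1 i - e 2 i
        ≡⟨ cancel-initial (e 1 i) (e 2 i) (e 3 i) ⟩
      e 3 i ∎

    sends-step : ∀ k → 2 ≤ k → 2 ℕ.+ k < d → Sends Mc (y k) (e k) → Sends Mc (y (1 ℕ.+ k)) (e (1 ℕ.+ k)) →
                 Sends Mc (y (2 ℕ.+ k)) (e (2 ℕ.+ k))
    sends-step k 2≤k h yₖ yₖ₊₁ = sends λ i → begin
      (Mc *ᵥ y (2 ℕ.+ k)) i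
        ≡⟨ image (sends-cong (y-step k 2≤k h)
             (sends-⊖ (sends-⊕ (sends-⊖ yₖ yₖ₊₁) (c-e (2 ℕ.+ k) (s≤s z≤n) (ℕP.<⇒≤ h))) (c-e k (1≤k 2≤k) (ℕP.m+n≤o⇒n≤o 3 h)))) i ⟩
      e k i - e (1 ℕ.+ k) i + c (2 ℕ.+ k) i - c k i
        ≡⟨ cong (λ z → e k i - e (1 ℕ.+ k) i + z - c k i) (c-step k 2≤k h i) ⟩
      e k i - e (1 ℕ.+ k) i + (c k i + e (1 ℕ.+ k) i + e (2 ℕ.+ k) i - e k i) - c k i
        ≡⟨ cancel-step (e k i) (e (1 ℕ.+ k) i) (e (2 ℕ.+ k) i) (c k i) ⟩
      e (2 ℕ.+ k) i ∎

    sends-last : Sends Mc (y (3 ℕ.+ t)) (e (3 ℕ.+ t)) → Sends Mc (y d) (e d)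
    sends-last y₃₊ₜ = sends λ i → begin
      (Mc *ᵥ y d) i
        ≡⟨ image (sends-cong y-last (sends-⊕ (sends-⊖ y₃₊ₜ (c-e (3 ℕ.+ t) (s≤s z≤n) 3+t≤d)) (c-e d (s≤s z≤n) ℕP.≤-refl))) i ⟩
      e (3 ℕ.+ t) i - c (3 ℕ.+ t) i + c d i
        ≡⟨ cong (λ z → e (3 ℕ.+ t) i - c (3 ℕ.+ t) i + z) (c-last i) ⟩
      e (3 ℕ.+ t) i - c (3 ℕ.+ t) i + (c (3 ℕ.+ t) i - e (3 ℕ.+ t) i + e d i)
        ≡⟨ cancel-last (e (3 ℕ.+ t) i) (c (3 ℕ.+ t) i) (e d i) ⟩
      e d i ∎

  My-sends-c : ∀ k → 1 ≤ k → k ≤ d → Sends My (c k) (e k)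
  My-sends-c = column-induction t (λ k → Sends My (c k) (e k)) sends-1 sends-2 sends-3 sends-step sends-last
    where
    sends-1 : Sends My (c 1) (e 1)
    sends-1 = sends-cong c-1 y-e₁

    sends-2 : Sends My (c 2) (e 2)
    sends-2 = sends-cong c-2 y-e₂

    sends-3 : Sends My (c 3) (e 3)
    sends-3 = sends λ i → begin
      (My *ᵥ c 3) i
        ≡⟨ image (sends-cong c-3 (sends-⊕ (sends-⊕ y-e₁ y-e₂) (y-e 3 (s≤s z≤n) 3≤d))) i ⟩
      e 1 i + e 2 i + y 3 i
        ≡⟨ cong (λ z → e 1 i + e 2 i + z) (y-3 i) ⟩
      e 1 i + e 2 i + (e 3 i - e 1 i - e 2 i)
        ≡⟨ cancel-initial′ (e 1 i) (e 2 i) (e 3 i) ⟩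
      e 3 i ∎

    sends-step : ∀ k → 2 ≤ k → 2 ℕ.+ k < d → Sends My (c k) (e k) → Sends My (c (1 ℕ.+ k)) (e (1 ℕ.+ k)) →
                 Sends My (c (2 ℕ.+ k)) (e (2 ℕ.+ k))
    sends-step k 2≤k h cₖ _ = sends λ i → begin
      (My *ᵥ c (2 ℕ.+ k)) i
        ≡⟨ image (sends-cong (c-step k 2≤k h)
             (sends-⊖ (sends-⊕ (sends-⊕ cₖ (y-e (1 ℕ.+ k) (s≤s z≤n) (ℕP.m+n≤o⇒n≤o 2 h)))
                               (y-e (2 ℕ.+ k) (s≤s z≤n) (ℕP.<⇒≤ h)))
                      (y-e k (1≤k 2≤k) (ℕP.m+n≤o⇒n≤o 3 h)))) i ⟩
      e k i + y (1 ℕ.+ k) i + y (2 ℕ.+ k) i - y k i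
        ≡⟨ cong (λ z → e k i + y (1 ℕ.+ k) i + z - y k i) (y-step k 2≤k h i) ⟩
      e k i + y (1 ℕ.+ k) i + (y k i - y (1 ℕ.+ k) i + e (2 ℕ.+ k) i - e k i) - y k i
        ≡⟨ cancel-step′ (e k i) (e (2 ℕ.+ k) i) (y k i) (y (1 ℕ.+ k) i) ⟩
      e (2 ℕ.+ k) i ∎

    sends-last : Sends My (c (3 ℕ.+ t)) (e (3 ℕ.+ t)) → Sends My (c d) (e d)
    sends-last c₃₊ₜ = sends λ i → begin
      (My *ᵥ c d) i
        ≡⟨ image (sends-cong c-last (sends-⊕ (sends-⊖ c₃₊ₜ (y-e (3 ℕ.+ t) (s≤s z≤n) 3+t≤d)) (y-e d (s≤s z≤n) ℕP.≤-refl))) i ⟩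
      e (3 ℕ.+ t) i - y (3 ℕ.+ t) i + y d i
        ≡⟨ cong (λ z → e (3 ℕ.+ t) i - y (3 ℕ.+ t) i + z) (y-last i) ⟩
      e (3 ℕ.+ t) i - y (3 ℕ.+ t) i + (y (3 ℕ.+ t) i - e (3 ℕ.+ t) i + e d i)
        ≡⟨ cancel-last (e (3 ℕ.+ t) i) (y (3 ℕ.+ t) i) (e d i) ⟩
      e d i ∎

  inverse-from-recurrences : IsInverseOf (fromCols y) (fromCols c)
  inverse-from-recurrences = product-is-identity Mc y Mc-sends-y , product-is-identity My c My-sends-c

-- Coefficient of E_i in the closed form of column k of Y (2 ≤ i < k).
fibCoeff : ℕ → ℕ → ℤ
fibCoeff k i = sign k * sign i * F (k ∸ i)

fibCoeff-rec : ∀ k i → i ≤ k → fibCoeff (2 ℕ.+ k) i ≡ fibCoeff k i - fibCoeff (1 ℕ.+ k) i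
fibCoeff-rec k i i≤k = begin
  sign (2 ℕ.+ k) * sign i * F (2 ℕ.+ k ∸ i)     ≡⟨ cong (λ x → sign (2 ℕ.+ k) * sign i * F x) (ℕP.+-∸-assoc 2 i≤k) ⟩
  sign (2 ℕ.+ k) * sign i * F (2 ℕ.+ (k ∸ i))   ≡⟨ fib-step (sign k) (sign i) (F (1 ℕ.+ (k ∸ i))) (F (k ∸ i)) ⟩
  sign k * sign i * F (k ∸ i) - sign (1 ℕ.+ k) * sign i * F (1 ℕ.+ (k ∸ i))
    ≡⟨ cong (λ x → sign k * sign i * F (k ∸ i) - sign (1 ℕ.+ k) * sign i * F x) (sym (ℕP.+-∸-assoc 1 i≤k)) ⟩
  sign k * sign i * F (k ∸ i) - sign (1 ℕ.+ k) * sign i * F (1 ℕ.+ k ∸ i) ∎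
  where
  open ≡-Reasoning
  fib-step : ∀ σ τ f₁ f₀ → - + 1 * (- + 1 * σ) * τ * (f₁ + f₀) ≡ σ * τ * f₀ - - + 1 * σ * τ * f₁
  fib-step = solve-∀

-- The entries next to the diagonal: F 1 = F 2 = 1 with signs -1 and +1.
fibCoeff-below₁ : ∀ k → fibCoeff (1 ℕ.+ k) k ≡ - + 1
fibCoeff-below₁ k = begin
  - + 1 * sign k * sign k * F (1 ℕ.+ k ∸ k)   ≡⟨ cong (λ x → - + 1 * sign k * sign k * F x) (ℕP.m+n∸n≡m 1 k) ⟩
  - + 1 * sign k * sign k * + 1              ≡⟨ negate (sign k) ⟩
  - (sign k * sign k)                        ≡⟨ cong -_ (sign-sq k) ⟩
  - + 1                                      ∎
  where
  open ≡-Reasoning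
  negate : ∀ σ → - + 1 * σ * σ * + 1 ≡ - (σ * σ)
  negate = solve-∀

fibCoeff-below₂ : ∀ k → fibCoeff (2 ℕ.+ k) k ≡ + 1
fibCoeff-below₂ k = begin
  - + 1 * (- + 1 * sign k) * sign k * F (2 ℕ.+ k ∸ k) ≡⟨ cong (λ x → - + 1 * (- + 1 * sign k) * sign k * F x) (ℕP.m+n∸n≡m 2 k) ⟩
  - + 1 * (- + 1 * sign k) * sign k * + 1             ≡⟨ square (sign k) ⟩
  sign k * sign k                                     ≡⟨ sign-sq k ⟩
  + 1                                                 ∎
  where
  open ≡-Reasoning
  square : ∀ σ → - + 1 * (- + 1 * σ) * σ * + 1 ≡ σ * σ
  square = solve-∀

-- The Fibonacci part of column k of Y against a coordinate function E (later E_i = (e^i)_j):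
-- its i-th summand, counted from i = 2, is fibCoeff k (2+i) E_{2+i}.
fibTerm : (ℕ → ℤ) → ℕ → ℕ → ℤ
fibTerm E k i = fibCoeff k (2 ℕ.+ i) * E (2 ℕ.+ i)

-- Closed form of column 2+m of Y: (-1)^m F_m E_1 + Σ_{2≤i≤m+1} fibCoeff (2+m) i E_i,
-- plus the diagonal term E_{2+m}.
yOffDiag : ℕ → (ℕ → ℤ) → ℤ
yOffDiag m E = sign m * F m * E 1 + sumUpTo m (fibTerm E (2 ℕ.+ m))

yForm : ℕ → (ℕ → ℤ) → ℤ
yForm m E = yOffDiag m E + E (2 ℕ.+ m)

fibSum-3+m : ∀ m E → sumUpTo (1 ℕ.+ m) (fibTerm E (3 ℕ.+ m)) ≡ sumUpTo m (fibTerm E (3 ℕ.+ m)) - E (2 ℕ.+ m)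
fibSum-3+m m E =
  trans (sumUpTo-snoc m (fibTerm E (3 ℕ.+ m)))
        (trans (cong (λ x → Q + x * E (2 ℕ.+ m)) (fibCoeff-below₁ (2 ℕ.+ m))) (minus-one Q (E (2 ℕ.+ m))))
  where
  Q = sumUpTo m (fibTerm E (3 ℕ.+ m))
  minus-one : ∀ q x → q + - + 1 * x ≡ q - x
  minus-one = solve-∀

-- The sum in column 4+m: on the common range the Fibonacci recurrence splits it into the
-- sums of columns 2+m and 3+m; the two new entries are +E_{2+m} and -E_{3+m}.
fibSum-4+m : ∀ m E → sumUpTo (2 ℕ.+ m) (fibTerm E (4 ℕ.+ m))
  ≡ sumUpTo m (fibTerm E (2 ℕ.+ m)) - sumUpTo m (fibTerm E (3 ℕ.+ m)) + E (2 ℕ.+ m) - E (3 ℕ.+ m)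
fibSum-4+m m E = begin
  sumUpTo (2 ℕ.+ m) (X (4 ℕ.+ m))
    ≡⟨ trans (sumUpTo-snoc (1 ℕ.+ m) (X (4 ℕ.+ m))) (cong (λ z → z + X (4 ℕ.+ m) (1 ℕ.+ m)) (sumUpTo-snoc m (X (4 ℕ.+ m)))) ⟩
  sumUpTo m (X (4 ℕ.+ m)) + X (4 ℕ.+ m) m + X (4 ℕ.+ m) (1 ℕ.+ m)
    ≡⟨ cong₂ (λ a y → a + X (4 ℕ.+ m) m + y * E (3 ℕ.+ m)) recurrence (fibCoeff-below₁ (3 ℕ.+ m)) ⟩
  P - Q + fibCoeff (4 ℕ.+ m) (2 ℕ.+ m) * E (2 ℕ.+ m) + - + 1 * E (3 ℕ.+ m)
    ≡⟨ cong (λ x → P - Q + x * E (2 ℕ.+ m) + - + 1 * E (3 ℕ.+ m)) (fibCoeff-below₂ (2 ℕ.+ m)) ⟩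
  P - Q + + 1 * E (2 ℕ.+ m) + - + 1 * E (3 ℕ.+ m)
    ≡⟨ unit-coefficients (P - Q) (E (2 ℕ.+ m)) (E (3 ℕ.+ m)) ⟩
  P - Q + E (2 ℕ.+ m) - E (3 ℕ.+ m) ∎
  where
  open ≡-Reasoning
  X = fibTerm E
  P = sumUpTo m (X (2 ℕ.+ m))
  Q = sumUpTo m (X (3 ℕ.+ m))

  distrib : ∀ a b x → (a - b) * x ≡ a * x - b * x
  distrib = solve-∀

  unit-coefficients : ∀ s x y → s + + 1 * x + - + 1 * y ≡ s + x - y
  unit-coefficients = solve-∀

  recurrence : sumUpTo m (X (4 ℕ.+ m)) ≡ P - Q
  recurrence = trans
    (sumUpTo-cong m (λ i i<m →
      trans (cong (_* E (2 ℕ.+ i)) (fibCoeff-rec (2 ℕ.+ m) (2 ℕ.+ i) (s≤s (s≤s (ℕP.<⇒≤ i<m)))))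
            (distrib (fibCoeff (2 ℕ.+ m) (2 ℕ.+ i)) (fibCoeff (3 ℕ.+ m) (2 ℕ.+ i)) (E (2 ℕ.+ i)))))
    (sumUpTo-- m (X (2 ℕ.+ m)) (X (3 ℕ.+ m)))

yForm-step : ∀ m E → yForm (2 ℕ.+ m) E ≡ yForm m E - yForm (1 ℕ.+ m) E + E (4 ℕ.+ m) - E (2 ℕ.+ m)
yForm-step m E = begin
  yForm (2 ℕ.+ m) E
    ≡⟨ cong (λ z → sign (2 ℕ.+ m) * F (2 ℕ.+ m) * E 1 + z + E (4 ℕ.+ m)) (fibSum-4+m m E) ⟩
  sign (2 ℕ.+ m) * F (2 ℕ.+ m) * E 1 + (P - Q + E (2 ℕ.+ m) - E (3 ℕ.+ m)) + E (4 ℕ.+ m)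
    ≡⟨ rearrange (sign m) (F m) (F (1 ℕ.+ m)) (E 1) P Q (E (2 ℕ.+ m)) (E (3 ℕ.+ m)) (E (4 ℕ.+ m)) ⟩
  yForm m E - (sign (1 ℕ.+ m) * F (1 ℕ.+ m) * E 1 + (Q - E (2 ℕ.+ m)) + E (3 ℕ.+ m)) + E (4 ℕ.+ m) - E (2 ℕ.+ m)
    ≡⟨ cong (λ z → yForm m E - (sign (1 ℕ.+ m) * F (1 ℕ.+ m) * E 1 + z + E (3 ℕ.+ m)) + E (4 ℕ.+ m) - E (2 ℕ.+ m))
            (sym (fibSum-3+m m E)) ⟩
  yForm m E - yForm (1 ℕ.+ m) E + E (4 ℕ.+ m) - E (2 ℕ.+ m) ∎
  where
  open ≡-Reasoning
  P = sumUpTo m (fibTerm E (2 ℕ.+ m))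
  Q = sumUpTo m (fibTerm E (3 ℕ.+ m))
  -- sign (2+m) = sign m, sign (1+m) = -sign m and F_{m+2} = F_{m+1} + F_m hold by computation
  rearrange : ∀ σ f₀ f₁ e₁ p q x₂ x₃ x₄ →
    - + 1 * (- + 1 * σ) * (f₁ + f₀) * e₁ + (p - q + x₂ - x₃) + x₄
    ≡ σ * f₀ * e₁ + p + x₂ - (- + 1 * σ * f₁ * e₁ + (q - x₂) + x₃) + x₄ - x₂
  rearrange = solve-∀

c-odd-part c-even-part y-odd-part y-even-part : ∀ {d} → ℕ → Vec d
c-odd-part  k = e 1 ⊕ Σv 1 ((k ∸ 1) / 2) (λ i → e (2 ℕ.* i))
c-even-part k = Σv 1 ((k ∸ 2) / 2) (λ i → e (2 ℕ.* i ℕ.+ 1))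
y-odd-part  k = (- F (k ∸ 2)) · e 1 ⊕ Σv 2 (k ∸ 1) (λ i → ((- + 1) ^ (i ℕ.+ 1) * F (k ∸ i)) · e i)
y-even-part k = F (k ∸ 2) · e 1 ⊕ Σv 2 (k ∸ 1) (λ i → ((- + 1) ^ i * F (k ∸ i)) · e i)

module _ (n k : ℕ) (k≢1 : k ≢ 1) (k≢2 : k ≢ 2) (k≢n-1 : k ≢ n ∸ 1) where

  C4col-odd : isOdd k ≡ true → C4col n k ≡ c-odd-part k ⊕ e k
  C4col-odd k-odd rewrite ≢⇒≡ᵇ-false k≢1 | ≢⇒≡ᵇ-false k≢2 | ≢⇒≡ᵇ-false k≢n-1 | k-odd = refl

  C4col-even : isOdd k ≡ false → C4col n k ≡ c-even-part k ⊕ e k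
  C4col-even k-even rewrite ≢⇒≡ᵇ-false k≢1 | ≢⇒≡ᵇ-false k≢2 | ≢⇒≡ᵇ-false k≢n-1 | k-even = refl

  Ycol-odd : isOdd k ≡ true → Ycol n k ≡ y-odd-part k ⊕ e k
  Ycol-odd k-odd rewrite ≢⇒≡ᵇ-false k≢1 | ≢⇒≡ᵇ-false k≢2 | ≢⇒≡ᵇ-false k≢n-1 | k-odd = refl

  Ycol-even : isOdd k ≡ false → Ycol n k ≡ y-even-part k ⊕ e k
  Ycol-even k-even rewrite ≢⇒≡ᵇ-false k≢1 | ≢⇒≡ᵇ-false k≢2 | ≢⇒≡ᵇ-false k≢n-1 | k-even = refl

C4col-last : ∀ t → C4col (5 ℕ.+ t) (4 ℕ.+ t) ≡ c-odd-part (3 ℕ.+ t) ⊕ e (4 ℕ.+ t)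
C4col-last t rewrite ≡ᵇ-refl t = refl

Ycol-last : ∀ t → Ycol (5 ℕ.+ t) (4 ℕ.+ t) ≡ y-odd-part (3 ℕ.+ t) ⊕ e (4 ℕ.+ t)
Ycol-last t rewrite ≡ᵇ-refl t = refl

c-odd-part-sum : ∀ {d} s (j : Fin d) → c-odd-part (suc (double s)) j ≡ e 1 j + sumUpTo s (λ i → e (2 ℕ.* suc i) j)
c-odd-part-sum s j = cong (λ z → e 1 j + z)
  (trans (cong (λ b → Σv 1 b (λ i → e (2 ℕ.* i)) j) (half-double s)) (Σv-sumUpTo 1 s (λ i → e (2 ℕ.* i)) j))

c-even-part-sum : ∀ {d} s (j : Fin d) → c-even-part (double (suc s)) j ≡ sumUpTo s (λ i → e (2 ℕ.* suc i ℕ.+ 1) j)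
c-even-part-sum s j =
  trans (cong (λ b → Σv 1 b (λ i → e (2 ℕ.* i ℕ.+ 1)) j) (half-double s)) (Σv-sumUpTo 1 s (λ i → e (2 ℕ.* i ℕ.+ 1)) j)

-- The off-diagonal parts of Y are the closed forms yOffDiag: once the parity of k is
-- fixed, the signs (-1)^i resp. (-1)^{i+1} of the definition equal sign k · sign i.
y-even-part-sum : ∀ {d} s (j : Fin d) → y-even-part (double (suc s)) j ≡ yOffDiag (double s) (λ i → e i j)
y-even-part-sum s j = cong₂ _+_
  (cong (_* e 1 j) (sym (trans (cong (_* F (double s)) (sign-double s)) (*-identityˡ _))))
  (trans (Σv-sumUpTo 2 (suc (double s)) (λ i → ((- + 1) ^ i * F (double (suc s) ∸ i)) · e i) j)
         (sumUpTo-cong (double s) (λ i _ → cong (λ σ → σ * F (double (suc s) ∸ (2 ℕ.+ i)) * e (2 ℕ.+ i) j)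
            (sym (trans (cong (_* sign (2 ℕ.+ i)) (sign-double (suc s))) (*-identityˡ _))))))

y-odd-part-sum : ∀ {d} s (j : Fin d) → y-odd-part (suc (double (suc s))) j ≡ yOffDiag (suc (double s)) (λ i → e i j)
y-odd-part-sum s j = cong₂ _+_
  (cong (_* e 1 j) (sym (trans (cong (_* F (suc (double s))) (sign-suc-double s)) (-1*i≡-i _))))
  (trans (Σv-sumUpTo 2 (double (suc s)) (λ i → ((- + 1) ^ (i ℕ.+ 1) * F (suc (double (suc s)) ∸ i)) · e i) j)
         (sumUpTo-cong (suc (double s)) (λ i _ → cong (λ σ → σ * F (suc (double (suc s)) ∸ (2 ℕ.+ i)) * e (2 ℕ.+ i) j)
            (trans (^-distribˡ-+-* (- + 1) (2 ℕ.+ i) 1)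
            (trans (*-comm (sign (2 ℕ.+ i)) _)
                   (cong (_* sign (2 ℕ.+ i)) (sym (sign-suc-double (suc s)))))))))

module C₄-columns (t : ℕ) (n-odd : isOdd (3 ℕ.+ t) ≡ true) where
  private
    n = 5 ℕ.+ t
    d = 4 ℕ.+ t

  open ≡-Reasoning

  -- Interior columns of C₄ in summation form (column 2 is included in the even case).
  c-even-col : ∀ s → double (suc s) < d → ∀ j →
    C4col n (double (suc s)) j ≡ sumUpTo s (λ i → e (2 ℕ.* suc i ℕ.+ 1) j) + e (double (suc s)) j
  c-even-col zero    _ j = sym (+-identityˡ (e 2 j))
  c-even-col (suc s) h j =
    trans (cong-app (C4col-even n (double (suc (suc s))) (λ ()) (λ ()) (ℕP.<⇒≢ h) (isOdd-double (suc (suc s)))) j)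
          (cong (λ z → z + e (double (suc (suc s))) j) (c-even-part-sum (suc s) j))

  c-odd-col : ∀ s → suc (double (suc s)) < d → ∀ j →
    C4col n (suc (double (suc s))) j ≡ e 1 j + sumUpTo (suc s) (λ i → e (2 ℕ.* suc i) j) + e (suc (double (suc s))) j
  c-odd-col s h j =
    trans (cong-app (C4col-odd n (suc (double (suc s))) (λ ()) (λ ()) (ℕP.<⇒≢ h) (isOdd-suc-double (suc s))) j)
          (cong (λ z → z + e (suc (double (suc s))) j) (c-odd-part-sum (suc s) j))

  c-step : ∀ k → 2 ≤ k → 2 ℕ.+ k < d → C4col n (2 ℕ.+ k) ≗ C4col n k ⊕ e (1 ℕ.+ k) ⊕ e (2 ℕ.+ k) ⊖ e k
  c-step k 2≤k h j with parity k
  c-step _ ()         _ _ | even zero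
  c-step _ (s≤s ())   _ _ | odd zero
  c-step _ _          h j | even (suc s) = begin
    C4col n (double (suc (suc s))) j
      ≡⟨ c-even-col (suc s) h j ⟩
    sumUpTo (suc s) g + e (2 ℕ.+ k) j
      ≡⟨ cong (λ z → z + e (2 ℕ.+ k) j) (sumUpTo-snoc s g) ⟩
    sumUpTo s g + e (2 ℕ.* suc s ℕ.+ 1) j + e (2 ℕ.+ k) j
      ≡⟨ cong (λ x → sumUpTo s g + e x j + e (2 ℕ.+ k) j) (trans (ℕP.+-comm _ 1) (cong suc (2*≡double (suc s)))) ⟩
    sumUpTo s g + e (1 ℕ.+ k) j + e (2 ℕ.+ k) j
      ≡⟨ insert-diagonal (sumUpTo s g) (e k j) (e (1 ℕ.+ k) j) (e (2 ℕ.+ k) j) ⟩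
    sumUpTo s g + e k j + e (1 ℕ.+ k) j + e (2 ℕ.+ k) j - e k j
      ≡⟨ cong (λ z → z + e (1 ℕ.+ k) j + e (2 ℕ.+ k) j - e k j) (sym (c-even-col s (ℕP.m+n≤o⇒n≤o 2 h) j)) ⟩
    C4col n k j + e (1 ℕ.+ k) j + e (2 ℕ.+ k) j - e k j ∎
    where
    k = double (suc s)
    g = λ i → e (2 ℕ.* suc i ℕ.+ 1) j
    insert-diagonal : ∀ a x b c → a + b + c ≡ a + x + b + c - x
    insert-diagonal = solve-∀
  c-step _ _          h j | odd (suc s) = begin
    C4col n (suc (double (suc (suc s)))) j
      ≡⟨ c-odd-col (suc s) h j ⟩
    e 1 j + sumUpTo (suc (suc s)) g + e (2 ℕ.+ k) j
      ≡⟨ cong (λ z → e 1 j + z + e (2 ℕ.+ k) j) (sumUpTo-snoc (suc s) g) ⟩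
    e 1 j + (sumUpTo (suc s) g + e (2 ℕ.* suc (suc s)) j) + e (2 ℕ.+ k) j
      ≡⟨ cong (λ x → e 1 j + (sumUpTo (suc s) g + e x j) + e (2 ℕ.+ k) j) (2*≡double (suc (suc s))) ⟩
    e 1 j + (sumUpTo (suc s) g + e (1 ℕ.+ k) j) + e (2 ℕ.+ k) j
      ≡⟨ insert-diagonal (e 1 j) (sumUpTo (suc s) g) (e k j) (e (1 ℕ.+ k) j) (e (2 ℕ.+ k) j) ⟩
    e 1 j + sumUpTo (suc s) g + e k j + e (1 ℕ.+ k) j + e (2 ℕ.+ k) j - e k j
      ≡⟨ cong (λ z → z + e (1 ℕ.+ k) j + e (2 ℕ.+ k) j - e k j) (sym (c-odd-col s (ℕP.m+n≤o⇒n≤o 2 h) j)) ⟩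
    C4col n k j + e (1 ℕ.+ k) j + e (2 ℕ.+ k) j - e k j ∎
    where
    k = suc (double (suc s))
    g = λ i → e (2 ℕ.* suc i) j
    insert-diagonal : ∀ a s x b c → a + (s + b) + c ≡ a + s + x + b + c - x
    insert-diagonal = solve-∀

  y-col : ∀ m → 2 ℕ.+ m < d → ∀ j → Ycol n (2 ℕ.+ m) j ≡ yForm m (λ i → e i j)
  y-col m h j with parity m
  ... | even zero    = column-two (e 1 j) (e 2 j)
    where
    column-two : ∀ x y → y ≡ + 1 * + 0 * x + + 0 + y
    column-two = solve-∀
  ... | even (suc s) =
    trans (cong-app (Ycol-even n (double (suc (suc s))) (λ ()) (λ ()) (ℕP.<⇒≢ h) (isOdd-double (suc (suc s)))) j)
          (cong (λ z → z + e (double (suc (suc s))) j) (y-even-part-sum (suc s) j))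
  ... | odd s        =
    trans (cong-app (Ycol-odd n (suc (double (suc s))) (λ ()) (λ ()) (ℕP.<⇒≢ h) (isOdd-suc-double (suc s))) j)
          (cong (λ z → z + e (suc (double (suc s))) j) (y-odd-part-sum s j))

  y-step : ∀ k → 2 ≤ k → 2 ℕ.+ k < d → Ycol n (2 ℕ.+ k) ≗ Ycol n k ⊖ Ycol n (1 ℕ.+ k) ⊕ e (2 ℕ.+ k) ⊖ e k
  y-step _ (s≤s (s≤s {n = m} z≤n)) h j = begin
    Ycol n (4 ℕ.+ m) j                                        ≡⟨ y-col (2 ℕ.+ m) h j ⟩
    yForm (2 ℕ.+ m) E                                         ≡⟨ yForm-step m E ⟩
    yForm m E - yForm (1 ℕ.+ m) E + E (4 ℕ.+ m) - E (2 ℕ.+ m)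
      ≡⟨ cong₂ (λ a b → a - b + E (4 ℕ.+ m) - E (2 ℕ.+ m)) (sym (y-col m (ℕP.m+n≤o⇒n≤o 2 h) j)) (sym (y-col (1 ℕ.+ m) (ℕP.m+n≤o⇒n≤o 1 h) j)) ⟩
    Ycol n (2 ℕ.+ m) j - Ycol n (3 ℕ.+ m) j + E (4 ℕ.+ m) - E (2 ℕ.+ m) ∎
    where
    E = λ i → e i j

  private
    move-diagonal : ∀ u x y → u + y ≡ u + x - x + y
    move-diagonal = solve-∀

    3+t≢4+t : 3 ℕ.+ t ≢ 4 ℕ.+ t
    3+t≢4+t = ℕP.<⇒≢ ℕP.≤-refl

  c-last : C4col n d ≗ C4col n (3 ℕ.+ t) ⊖ e (3 ℕ.+ t) ⊕ e d
  c-last j = begin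
    C4col n d j
      ≡⟨ cong-app (C4col-last t) j ⟩
    c-odd-part (3 ℕ.+ t) j + e d j
      ≡⟨ move-diagonal (c-odd-part (3 ℕ.+ t) j) (e (3 ℕ.+ t) j) (e d j) ⟩
    c-odd-part (3 ℕ.+ t) j + e (3 ℕ.+ t) j - e (3 ℕ.+ t) j + e d j
      ≡⟨ cong (λ z → z - e (3 ℕ.+ t) j + e d j) (sym (cong-app (C4col-odd n (3 ℕ.+ t) (λ ()) (λ ()) 3+t≢4+t n-odd) j)) ⟩
    C4col n (3 ℕ.+ t) j - e (3 ℕ.+ t) j + e d j ∎

  y-last : Ycol n d ≗ Ycol n (3 ℕ.+ t) ⊖ e (3 ℕ.+ t) ⊕ e d
  y-last j = begin
    Ycol n d j
      ≡⟨ cong-app (Ycol-last t) j ⟩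
    y-odd-part (3 ℕ.+ t) j + e d j
      ≡⟨ move-diagonal (y-odd-part (3 ℕ.+ t) j) (e (3 ℕ.+ t) j) (e d j) ⟩
    y-odd-part (3 ℕ.+ t) j + e (3 ℕ.+ t) j - e (3 ℕ.+ t) j + e d j
      ≡⟨ cong (λ z → z - e (3 ℕ.+ t) j + e d j) (sym (cong-app (Ycol-odd n (3 ℕ.+ t) (λ ()) (λ ()) 3+t≢4+t n-odd) j)) ⟩
    Ycol n (3 ℕ.+ t) j - e (3 ℕ.+ t) j + e d j ∎

  recurrences : ColumnRecurrences t (C4col n) (Ycol n)
  recurrences = record
    { c-1    = λ _ → refl
    ; c-2    = λ _ → refl
    ; c-3    = λ j → trans (c-odd-col 0 3<d j) (cong (λ z → e 1 j + z + e 3 j) (+-identityʳ (e 2 j)))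
    ; c-step = c-step
    ; c-last = c-last
    ; y-1    = λ _ → refl
    ; y-2    = λ _ → refl
    ; y-3    = λ j → trans (y-col 1 3<d j) (column-three (e 1 j) (e 2 j) (e 3 j))
    ; y-step = y-step
    ; y-last = y-last
    }
    where
    3<d : 3 < d
    3<d = s≤s (s≤s (s≤s (s≤s z≤n)))
    column-three : ∀ a b c → - + 1 * a + (- + 1 * b + + 0) + c ≡ c - a - b
    column-three = solve-∀

C₄-inverse : ∀ t → isOdd (3 ℕ.+ t) ≡ true → IsInverseOf (Y (5 ℕ.+ t)) (C4 (5 ℕ.+ t))
C₄-inverse t n-odd = inverse-from-recurrences (C₄-columns.recurrences t n-odd)

lemma2p4 : (n : ℕ) → 7 ≤ n → n % 2 ≡ 1 → IsInverseOf (Y n) (C4 n)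
lemma2p4 _ (s≤s (s≤s (s≤s (s≤s (s≤s (s≤s (s≤s {n = t} z≤n))))))) n-odd = C₄-inverse (2 ℕ.+ t) (cong (_≡ᵇ 1) n-odd)
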